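{- Let $T$ be a tree and let $\sigma$ be the ordering of the vertices of $T$ obtained by breadth-first search starting from some leaf of $T$ ($\sigma(v)$ is the position of $v$). Let $T_1,\dots,T_n$ be mutually vertex-disjoint subtrees of $T$ such that $\min\{\sigma(v):v\in V(T_i)\}<\min\{\sigma(v):v\in V(T_j)\}$ for all $1\le i<j\le n$. Then for all integers $2\le i\le j\le n$, the subtrees $T_1\oplus\cdots\oplus T_{i-1}$ and $T_j$ are vertex-disjoint.
   Context: For vertex-disjoint subtrees $S_1,S_2$ of a tree, $S_1\oplus S_2$ denotes the smallest subtree containing both, i.e. $S_1$, $S_2$ and the path between them; $T_1\oplus\cdots\oplus T_{k}$ is formed iteratively. -}

module Defs where

open import Data.Nat using (ℕ; zero; suc; _<_)
open import Data.Fin using (Fin; _≟_)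
open import Data.List using (List; []; _∷_; _++_)
open import Data.List.Membership.Propositional using (_∈_; _∉_)
open import Data.List.Relation.Unary.All using (All)
open import Data.List.Relation.Unary.Unique.Propositional using (Unique)
open import Data.Product using (Σ; ∃; _×_; _,_)
open import Data.Empty using (⊥)
open import Relation.Nullary using (¬_; yes; no)
open import Relation.Binary.PropositionalEquality using (_≡_)

data Walk {m : ℕ} (E : Fin m → Fin m → Set) : Fin m → Fin m → List (Fin m) → Set where
  here : ∀ {a} → Walk E a a (a ∷ [])
  step : ∀ {a c b p} → E a c → Walk E c b p → Walk E a b (a ∷ p)

Path : {m : ℕ} → (Fin m → Fin m → Set) → Fin m → Fin m → List (Fin m) → Set
Path E a b p = Walk E a b p × Unique p

record Tree (m : ℕ) : Set₁ where
  field
    E          : Fin m → Fin m → Set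
    sym        : ∀ {u v} → E u v → E v u
    irrefl     : ∀ {u} → ¬ E u u
    connected  : ∀ u v → ∃ λ p → Path E u v p
    uniquePath : ∀ {u v p q} → Path E u v p → Path E u v q → p ≡ q
open Tree public

IsLeaf : {m : ℕ} → Tree m → Fin m → Set
IsLeaf G r = Σ _ λ u → E G r u × (∀ w → E G r w → w ≡ u)

VSet : ℕ → Set₁
VSet m = Fin m → Set

IsSubtree : {m : ℕ} → Tree m → VSet m → Set
IsSubtree G S = (∃ λ v → S v) ×
  (∀ u v → S u → S v → ∃ λ p → Path (E G) u v p × All S p)

Disjoint : {m : ℕ} → VSet m → VSet m → Set
Disjoint A B = ∀ v → A v → B v → ⊥

-- S₁ ⊕ S₂: S₁, S₂ and the path between them, i.e. all vertices lying on
-- a path from a vertex of S₁ to a vertex of S₂.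
_⊕_within_ : {m : ℕ} → VSet m → VSet m → Tree m → VSet m
(A ⊕ B within G) v = Σ _ λ a → Σ _ λ b → Σ _ λ p →
  A a × B b × Path (E G) a b p × v ∈ p

-- T₁ ⊕ ⋯ ⊕ Tₖ formed iteratively (1-based indexing; k = 0 gives ∅).
bigOplus : {m : ℕ} → Tree m → (ℕ → VSet m) → ℕ → VSet m
bigOplus G T zero = λ _ → ⊥
bigOplus G T (suc zero) = T 1
bigOplus G T (suc (suc k)) = bigOplus G T (suc k) ⊕ T (suc (suc k)) within G

-- Breadth-first search with a queue; the neighbours of the processed vertex
-- that are not yet visited are appended in an arbitrary order.
-- BFSRun G visited queue final.
data BFSRun {m : ℕ} (G : Tree m) : List (Fin m) → List (Fin m) → List (Fin m) → Set where
  done : ∀ {vis} → BFSRun G vis [] vis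
  step : ∀ {vis u q fin} (N : List (Fin m)) → Unique N →
         (∀ w → w ∈ N → E G u w × w ∉ vis) →
         (∀ w → E G u w → w ∉ vis → w ∈ N) →
         BFSRun G (vis ++ N) (q ++ N) fin →
         BFSRun G vis (u ∷ q) fin

IsBFSOrder : {m : ℕ} → Tree m → Fin m → List (Fin m) → Set
IsBFSOrder G r ord = BFSRun G (r ∷ []) (r ∷ []) ord

-- σ(v): position (0-based) of v in the list (length of the list if absent).
pos : {m : ℕ} → List (Fin m) → Fin m → ℕ
pos [] v = 0
pos (x ∷ xs) v with x ≟ v
... | yes _ = 0
... | no _ = suc (pos xs v)

MinLess : {m : ℕ} → (Fin m → ℕ) → VSet m → VSet m → Set
MinLess σ A B = Σ _ λ a → A a × (∀ b → B b → σ a < σ b)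

-- Root the tree at r and call v an ancestor of x when v lies on the path from r to x.
-- A breadth-first order lists every ancestor of a vertex no later than the vertex itself.
-- Every vertex of T₁ ⊕ ⋯ ⊕ Tᵢ₋₁ is an ancestor of a vertex of some Tₗ with l < i, and an
-- ancestor of a vertex of the subtree Tₗ either lies in Tₗ or is an ancestor of every vertex
-- of Tₗ, in particular of the BFS-first vertex a of Tₗ. A vertex of Tⱼ (j > l) comes strictly
-- after a, so it can be neither; hence the two sets are disjoint.
module Submission where

open import Defs
open import Data.Nat using (ℕ; zero; suc; _≤_; _<_; _∸_; z≤n; s≤s)
open import Data.Nat.Properties using (≤-refl; ≤-pred; ≤-trans; <⇒≤; <⇒≱; ≤-<-trans; <-≤-trans; n≤1+n; module ≤-Reasoning)
open import Data.Fin using (Fin; _≟_)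
open import Data.List using (List; []; _∷_; _++_; length)
open import Data.List.Membership.Propositional using (_∈_; _∉_)
open import Data.List.Membership.Propositional.Properties using (∈-++⁺ˡ; ∈-++⁺ʳ; ∈-++⁻)
open import Data.List.Membership.DecPropositional using (_∈?_)
open import Data.List.Relation.Binary.Subset.Propositional using (_⊆_)
open import Data.List.Relation.Unary.Any using (here; there)
open import Data.List.Relation.Unary.All using (All; []; _∷_; tabulate) renaming (lookup to All-lookup; map to All-map)
open import Data.List.Relation.Unary.All.Properties using (¬Any⇒All¬; ++⁺)
open import Data.List.Relation.Unary.AllPairs using ([]; _∷_)
open import Data.Product using (∃; _×_; _,_; proj₁; proj₂)
open import Data.Sum using (_⊎_; inj₁; inj₂)
open import Data.Empty using (⊥-elim)
open import Relation.Nullary using (yes; no)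
open import Relation.Binary.PropositionalEquality using (_≡_; refl; cong) renaming (sym to ≡-sym)

module _ {m : ℕ} where

  ∈⇒pos<length : ∀ {xs : List (Fin m)} {v} → v ∈ xs → pos xs v < length xs
  ∈⇒pos<length {x ∷ xs} {v} v∈ with x ≟ v | v∈
  ... | yes _  | _          = s≤s z≤n
  ... | no x≢v | here v≡x   = ⊥-elim (x≢v (≡-sym v≡x))
  ... | no _   | there v∈xs = s≤s (∈⇒pos<length v∈xs)

  pos-<⇒∈ : ∀ (xs : List (Fin m)) {a v} → pos xs a < pos xs v → a ∈ xs
  pos-<⇒∈ (x ∷ xs) {a} {v} a<v with x ≟ a | x ≟ v
  ... | yes x≡a | _     = here (≡-sym x≡a)
  ... | no _    | no _  = there (pos-<⇒∈ xs (≤-pred a<v))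
  pos-<⇒∈ (x ∷ xs) () | no _ | yes _

  pos-++ˡ : ∀ (xs ys : List (Fin m)) {v} → pos xs v < length xs → pos (xs ++ ys) v ≡ pos xs v
  pos-++ˡ (x ∷ xs) ys {v} v< with x ≟ v
  ... | yes _ = refl
  ... | no _  = cong suc (pos-++ˡ xs ys (≤-pred v<))

  length≤pos-++ : ∀ (xs ys : List (Fin m)) {v} → v ∉ xs → length xs ≤ pos (xs ++ ys) v
  length≤pos-++ []       ys v∉ = z≤n
  length≤pos-++ (x ∷ xs) ys {v} v∉ with x ≟ v
  ... | yes x≡v = ⊥-elim (v∉ (here (≡-sym x≡v)))
  ... | no _    = s≤s (length≤pos-++ xs ys (λ v∈xs → v∉ (there v∈xs)))

module _ {m : ℕ} {E : Fin m → Fin m → Set} where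

  start∈walk : ∀ {a b p} → Walk E a b p → a ∈ p
  start∈walk here       = here refl
  start∈walk (step _ _) = here refl

  end∈walk : ∀ {a b p} → Walk E a b p → b ∈ p
  end∈walk here       = here refl
  end∈walk (step _ w) = there (end∈walk w)

  walk-++ : ∀ {a b c p q} → Walk E a b p → Walk E b c q → ∃ λ s → Walk E a c s × s ⊆ p ++ q
  walk-++ here       w = _ , w , ∈-++⁺ʳ _
  walk-++ (step e w) w′ with walk-++ w w′
  ... | s , w″ , s⊆ = _ , step e w″ , λ { (here refl) → here refl ; (there x∈s) → there (s⊆ x∈s) }

  walk-reverse : (∀ {u v} → E u v → E v u) → ∀ {a b p} → Walk E a b p → ∃ λ q → Walk E b a q × q ⊆ p
  walk-reverse E-sym here = _ , here , λ x∈ → x∈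
  walk-reverse E-sym (step {a} e w) with walk-reverse E-sym w
  ... | q , w⁻ , q⊆ with walk-++ w⁻ (step (E-sym e) here)
  ... | s , w′ , s⊆ = s , w′ , λ x∈s → back (∈-++⁻ q (s⊆ x∈s))
    where
    back : ∀ {x} → x ∈ q ⊎ x ∈ _ ∷ a ∷ [] → x ∈ a ∷ _
    back (inj₁ x∈q)                 = there (q⊆ x∈q)
    back (inj₂ (here refl))         = there (start∈walk w)
    back (inj₂ (there (here refl))) = here refl

  walk-prefix : ∀ {s t p a} → Walk E s t p → a ∈ p → ∃ λ q → Walk E s a q × q ⊆ p
  walk-prefix here       (here refl) = _ , here , λ x∈ → x∈
  walk-prefix (step e w) (here refl) = _ , here , λ { (here refl) → here refl }
  walk-prefix (step e w) (there a∈p) with walk-prefix w a∈p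
  ... | q , w′ , q⊆ = _ , step e w′ , λ { (here refl) → here refl ; (there x∈q) → there (q⊆ x∈q) }

  path-suffix : ∀ {c b q a} → Path E c b q → a ∈ q → ∃ λ q′ → Path E a b q′ × q′ ⊆ q
  path-suffix π@(here , _)     (here refl) = _ , π , λ x∈ → x∈
  path-suffix π@(step _ _ , _) (here refl) = _ , π , λ x∈ → x∈
  path-suffix (step e w , _ ∷ u) (there a∈q) with path-suffix (w , u) a∈q
  ... | q′ , π′ , q′⊆ = q′ , π′ , λ x∈ → there (q′⊆ x∈)

  -- Loop erasure: if the new first vertex already lies on the erased rest, keep only the suffix from it.
  walk⇒path : ∀ {a b p} → Walk E a b p → ∃ λ q → Path E a b q × q ⊆ p
  walk⇒path here = _ , (here , [] ∷ []) , λ x∈ → x∈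
  walk⇒path (step {a} e w) with walk⇒path w
  ... | q , (wq , uq) , q⊆ with _∈?_ _≟_ a q
  ... | yes a∈q with path-suffix (wq , uq) a∈q
  ...   | q′ , π , q′⊆ = q′ , π , λ x∈ → there (q⊆ (q′⊆ x∈))
  walk⇒path (step {a} e w) | q , (wq , uq) , q⊆ | no a∉q =
    a ∷ q , (step e wq , ¬Any⇒All¬ q a∉q ∷ uq) , λ { (here refl) → here refl ; (there x∈q) → there (q⊆ x∈q) }

path⊆walk : ∀ {m} (G : Tree m) {u w L p} → Walk (E G) u w L → Path (E G) u w p → p ⊆ L
path⊆walk G w π with walk⇒path w
... | q , π′ , q⊆ rewrite uniquePath G π π′ = q⊆

module Rooted {m : ℕ} (G : Tree m) (r : Fin m) where

  rootPath : Fin m → List (Fin m)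
  rootPath x = proj₁ (connected G r x)

  rootWalk : ∀ x → Walk (E G) r x (rootPath x)
  rootWalk x = proj₁ (proj₂ (connected G r x))

  _≼_ : Fin m → Fin m → Set
  v ≼ x = v ∈ rootPath x

  ≼-walk : ∀ {v x L} → Walk (E G) r x L → v ≼ x → v ∈ L
  ≼-walk {x = x} w = path⊆walk G w (proj₂ (connected G r x))

  ≼-refl : ∀ {x} → x ≼ x
  ≼-refl {x} = end∈walk (rootWalk x)

  ≼-root : ∀ {v} → v ≼ r → v ≡ r
  ≼-root v≼r with ≼-walk here v≼r
  ... | here v≡r = v≡r

  ≼-trans : ∀ {v a x} → v ≼ a → a ≼ x → v ≼ x
  ≼-trans v≼a a≼x with walk-prefix (rootWalk _) a≼x
  ... | q , w , q⊆ = q⊆ (≼-walk w v≼a)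

  ≼-step : ∀ {u w v} → E G u w → v ≼ w → v ≡ w ⊎ v ≼ u
  ≼-step {u} e v≼w with walk-++ (rootWalk u) (step e here)
  ... | s , w′ , s⊆ with ∈-++⁻ (rootPath u) (s⊆ (≼-walk w′ v≼w))
  ... | inj₁ v≼u                 = inj₂ v≼u
  ... | inj₂ (here refl)         = inj₂ ≼-refl
  ... | inj₂ (there (here refl)) = inj₁ refl

  path-≼ : ∀ {a b p v} → Path (E G) a b p → v ∈ p → v ≼ a ⊎ v ≼ b
  path-≼ {a} {b} π v∈p with walk-reverse (sym G) (rootWalk a)
  ... | q , w⁻ , q⊆ with walk-++ w⁻ (rootWalk b)
  ... | s , w , s⊆ with ∈-++⁻ q (s⊆ (path⊆walk G w π v∈p))
  ... | inj₁ v∈q  = inj₁ (q⊆ v∈q)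
  ... | inj₂ v≼b = inj₂ v≼b

  Above : VSet m → VSet m
  Above S v = ∃ λ x → S x × v ≼ x

  Above-≼ : ∀ {S a v} → Above S a → v ≼ a → Above S v
  Above-≼ (x , Sx , a≼x) v≼a = x , Sx , ≼-trans v≼a a≼x

  ⊕-Above : ∀ {A B v} → (A ⊕ B within G) v → Above A v ⊎ Above B v
  ⊕-Above (a , b , p , Aa , Bb , π , v∈p) with path-≼ π v∈p
  ... | inj₁ v≼a = inj₁ (a , Aa , v≼a)
  ... | inj₂ v≼b = inj₂ (b , Bb , v≼b)

  bigOplus-Above : ∀ (T : ℕ → VSet m) k {v} → bigOplus G T (suc k) v →
                   ∃ λ l → 1 ≤ l × l ≤ suc k × Above (T l) v
  bigOplus-Above T zero T₁v = 1 , ≤-refl , ≤-refl , _ , T₁v , ≼-refl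
  bigOplus-Above T (suc k) v∈⊕ with ⊕-Above v∈⊕
  ... | inj₂ above = suc (suc k) , s≤s z≤n , ≤-refl , above
  ... | inj₁ (a , a∈⊕ , v≼a) with bigOplus-Above T k a∈⊕
  ...   | l , 1≤l , l≤ , above = l , 1≤l , ≤-trans l≤ (n≤1+n _) , Above-≼ above v≼a

  Above-subtree : ∀ {S a v} → IsSubtree G S → S a → Above S v → S v ⊎ v ≼ a
  Above-subtree {a = a} (_ , S-connected) Sa (x , Sx , v≼x) with S-connected a x Sa Sx
  ... | p , (w , _) , All-S-p with walk-++ (rootWalk a) w
  ... | s , w′ , s⊆ with ∈-++⁻ (rootPath a) (s⊆ (≼-walk w′ v≼x))
  ... | inj₁ v≼a = inj₂ v≼a
  ... | inj₂ v∈p = inj₁ (All-lookup All-S-p v∈p)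

  AncestorsFirst : List (Fin m) → Set
  AncestorsFirst vis = ∀ {v w} → w ∈ vis → v ≼ w → pos vis v ≤ pos vis w

  ancestorsFirst-root : AncestorsFirst (r ∷ [])
  ancestorsFirst-root (here refl) v≼r rewrite ≼-root v≼r = ≤-refl

  -- A newly queued w is a child of the visited u, so its proper ancestors are already visited.
  ancestorsFirst-++ : ∀ {vis u} (N : List (Fin m)) → AncestorsFirst vis → u ∈ vis →
                      (∀ w → w ∈ N → E G u w × w ∉ vis) → AncestorsFirst (vis ++ N)
  ancestorsFirst-++ {vis} {u} N first u∈vis children {v} {w} w∈ v≼w with ∈-++⁻ vis w∈
  ... | inj₁ w∈vis
    rewrite pos-++ˡ vis N (≤-<-trans (first w∈vis v≼w) (∈⇒pos<length w∈vis))
          | pos-++ˡ vis N (∈⇒pos<length w∈vis) = first w∈vis v≼w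
  ... | inj₂ w∈N with children w w∈N
  ... | uw , w∉vis with ≼-step uw v≼w
  ... | inj₁ refl = ≤-refl
  ... | inj₂ v≼u = begin
    pos (vis ++ N) v ≡⟨ pos-++ˡ vis N v<length ⟩
    pos vis v        <⟨ v<length ⟩
    length vis       ≤⟨ length≤pos-++ vis N w∉vis ⟩
    pos (vis ++ N) w ∎
    where
    open ≤-Reasoning
    v<length : pos vis v < length vis
    v<length = ≤-<-trans (first u∈vis v≼u) (∈⇒pos<length u∈vis)

  bfsRun-ancestorsFirst : ∀ {vis q fin} → BFSRun G vis q fin →
                          AncestorsFirst vis → All (_∈ vis) q → AncestorsFirst fin
  bfsRun-ancestorsFirst done first _ = first
  bfsRun-ancestorsFirst (step {vis} N _ children _ run) first (u∈vis ∷ q⊆vis) =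
    bfsRun-ancestorsFirst run (ancestorsFirst-++ N first u∈vis children)
      (++⁺ (All-map ∈-++⁺ˡ q⊆vis) (tabulate (∈-++⁺ʳ vis)))

  bfsOrder-ancestorsFirst : ∀ {ord} → IsBFSOrder G r ord → AncestorsFirst ord
  bfsOrder-ancestorsFirst bfs = bfsRun-ancestorsFirst bfs ancestorsFirst-root (here refl ∷ [])

  Above-disjoint : ∀ {ord S S′} → AncestorsFirst ord → IsSubtree G S → Disjoint S S′ →
                   MinLess (pos ord) S S′ → Disjoint (Above S) S′
  Above-disjoint {ord} first subtree disjoint (a , Sa , a-first) v above S′v
    with Above-subtree subtree Sa above
  ... | inj₁ Sv  = disjoint v Sv S′v
  ... | inj₂ v≼a = <⇒≱ a<v (first (pos-<⇒∈ ord a<v) v≼a)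
    where
    a<v : pos ord a < pos ord v
    a<v = a-first v S′v

open Rooted

mainTheorem9 : {m : ℕ} (G : Tree m) (r : Fin m) → IsLeaf G r →
    (ord : List (Fin m)) → IsBFSOrder G r ord →
    (n : ℕ) (T : ℕ → VSet m) →
    (∀ i → 1 ≤ i → i ≤ n → IsSubtree G (T i)) →
    (∀ i j → 1 ≤ i → i < j → j ≤ n → Disjoint (T i) (T j)) →
    (∀ i j → 1 ≤ i → i < j → j ≤ n → MinLess (pos ord) (T i) (T j)) →
    ∀ i j → 2 ≤ i → i ≤ j → j ≤ n →
    Disjoint (bigOplus G T (i ∸ 1)) (T j)
mainTheorem9 G r _ ord bfs n T subtree disjoint minLess (suc (suc i)) j (s≤s (s≤s z≤n)) i≤j j≤n v v∈⊕ Tⱼv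
  with bigOplus-Above G r T i v∈⊕
... | l , 1≤l , l≤1+i , above =
  Above-disjoint G r (bfsOrder-ancestorsFirst G r bfs) (subtree l 1≤l (<⇒≤ (<-≤-trans l<j j≤n)))
    (disjoint l j 1≤l l<j j≤n) (minLess l j 1≤l l<j j≤n) v above Tⱼv
  where
  l<j : l < j
  l<j = ≤-trans (s≤s l≤1+i) i≤j
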